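{- Let $\mathbb{H}=(\mathcal{P}(X),\mathcal{P}(Y),[\ni]^{\mathbb{H}},\langle\not\ni\rangle^{\mathbb{H}},\langle\nu\rangle^{\mathbb{H}},[\nu^c]^{\mathbb{H}})$ be a perfect supported heterogeneous m-algebra. Then $\mathbb{H}_+$ is a supported two-sorted n-frame.
   Context: A heterogeneous m-algebra is a structure $(\mathbb{A},\mathbb{B},[\ni],\langle\not\ni\rangle,\langle\nu\rangle,[\nu^c])$ with $\mathbb{A},\mathbb{B}$ Boolean algebras, $\langle\nu\rangle,[\nu^c]:\mathbb{B}\to\mathbb{A}$ finitely join-preserving and finitely meet-preserving respectively, and $[\ni],\langle\not\ni\rangle:\mathbb{A}\to\mathbb{B}$ finitely meet-preserving and finitely join-preserving respectively. It is perfect if $\mathbb{A},\mathbb{B}$ are complete atomic Boolean algebras (hence identified with powersets $\mathcal{P}(X)$, $\mathcal{P}(Y)$) and the maps preserve arbitrary joins/meets accordingly. It is supported if $\langle\nu\rangle[\ni]a=[\nu^c]\langle\not\ni\rangle a$ for all $a\in\mathbb{A}$. For such a perfect $\mathbb{H}$, $\mathbb{H}_+=(X,Y,R_\ni,R_{\not\ni},R_\nu,R_{\nu^c})$ where $R_\ni,R_{\not\ni}\subseteq Y\times X$ and $R_\nu,R_{\nu^c}\subseteq X\times Y$ are given by: $yR_\ni x$ iff $y\notin[\ni]^{\mathbb{H}}(X\setminus\{x\})$; $yR_{\not\ni}x$ iff $y\in\langle\not\ni\rangle^{\mathbb{H}}\{x\}$; $xR_\nu y$ iff $x\in\langle\nu\rangle^{\mathbb{H}}\{y\}$;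 $xR_{\nu^c}y$ iff $x\notin[\nu^c]^{\mathbb{H}}(Y\setminus\{y\})$. A two-sorted n-frame is a tuple $(X,Y,R_\ni,R_{\not\ni},R_\nu,R_{\nu^c})$ of this shape with $X,Y$ nonempty; it is supported if for every $D\subseteq X$: $R_\nu^{ -1}[(R_\ni^{ -1}[D^c])^c]=(R_{\nu^c}^{ -1}[(R_{\not\ni}^{ -1}[D])^c])^c$, where $R^{ -1}[T']=\{s\mid\exists t\in T',\ sRt\}$ and $(\cdot)^c$ is complement. -}

module Defs where

open import Data.Product using (Σ; _×_; _,_)
open import Relation.Nullary using (¬_)
open import Relation.Binary.PropositionalEquality using (_≡_)

-- Powerset 𝒫(X) rendered as predicates on X.
Subset : Set → Set₁
Subset X = X → Set

_≐_ : {X : Set} → Subset X → Subset X → Set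
A ≐ B = (∀ x → A x → B x) × (∀ x → B x → A x)

∁ : {X : Set} → Subset X → Subset X
∁ A x = ¬ A x

｛_｝ : {X : Set} → X → Subset X
｛ x ｝ = λ x' → x' ≡ x

allBut : {X : Set} → X → Subset X
allBut x = λ x' → ¬ (x' ≡ x)

⋃ : {X : Set} {I : Set} → (I → Subset X) → Subset X
⋃ {I = I} F x = Σ I (λ i → F i x)

⋂ : {X : Set} {I : Set} → (I → Subset X) → Subset X
⋂ {I = I} F x = (i : I) → F i x

-- A map 𝒫(X) → 𝒫(Y) must be well defined on extensional subsets.
Respects≐ : {X Y : Set} → (Subset X → Subset Y) → Set₁
Respects≐ {X} f = (A B : Subset X) → A ≐ B → f A ≐ f B

PreservesJoins : {X Y : Set} → (Subset X → Subset Y) → Set₁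
PreservesJoins {X} f = (I : Set) (F : I → Subset X) → f (⋃ F) ≐ ⋃ (λ i → f (F i))

PreservesMeets : {X Y : Set} → (Subset X → Subset Y) → Set₁
PreservesMeets {X} f = (I : Set) (F : I → Subset X) → f (⋂ F) ≐ ⋂ (λ i → f (F i))

record PerfectHMA (X Y : Set) : Set₁ where
  field
    box∋   : Subset X → Subset Y
    dia∌   : Subset X → Subset Y
    diaν   : Subset Y → Subset X
    boxνc  : Subset Y → Subset X
    box∋-resp  : Respects≐ box∋
    dia∌-resp  : Respects≐ dia∌
    diaν-resp  : Respects≐ diaν
    boxνc-resp : Respects≐ boxνc
    box∋-meets  : PreservesMeets box∋
    dia∌-joins  : PreservesJoins dia∌
    diaν-joins  : PreservesJoins diaν
    boxνc-meets : PreservesMeets boxνc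

SupportedHMA : {X Y : Set} → PerfectHMA X Y → Set₁
SupportedHMA {X} H = (a : Subset X) → diaν (box∋ a) ≐ boxνc (dia∌ a)
  where open PerfectHMA H

record NFrame : Set₁ where
  field
    X Y  : Set
    x₀   : X
    y₀   : Y
    R∋   : Y → X → Set
    R∌   : Y → X → Set
    Rν   : X → Y → Set
    Rνc  : X → Y → Set

preimage : {S T : Set} → (S → T → Set) → Subset T → Subset S
preimage {T = T} R T' s = Σ T (λ t → R s t × T' t)

SupportedFrame : NFrame → Set₁
SupportedFrame F =
  (D : Subset X) →
    preimage Rν (∁ (preimage R∋ (∁ D)))
      ≐ ∁ (preimage Rνc (∁ (preimage R∌ D)))
  where open NFrame F

-- ℍ₊ (nonemptiness witnesses supplied since n-frames require X, Y ≠ ∅).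
_₊ : {X Y : Set} → PerfectHMA X Y → X → Y → NFrame
_₊ {X} {Y} H x₀ y₀ = record
  { X = X ; Y = Y ; x₀ = x₀ ; y₀ = y₀
  ; R∋  = λ y x → ¬ box∋ (allBut x) y
  ; R∌  = λ y x → dia∌ ｛ x ｝ y
  ; Rν  = λ x y → diaν ｛ y ｝ x
  ; Rνc = λ x y → ¬ boxνc (allBut y) x
  }
  where open PerfectHMA H

-- Each relation of ℍ₊ records the value of one operation of ℍ on an atom
-- ({x}, for ⟨∌⟩ and ⟨ν⟩) or a coatom (X ∖ {x}, for [∋] and [νᶜ]).  Since
-- the diamonds preserve arbitrary joins and every subset is the join of its
-- atoms, R⁻¹[S] recovers ⟨·⟩S; dually, since the boxes preserve arbitrary
-- meets and every subset is the meet of the coatoms above it (classically),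
-- (R⁻¹[Dᶜ])ᶜ recovers [·]D.  The two sides of the frame condition are thus
-- ⟨ν⟩[∋]D and [νᶜ]⟨∌⟩D, which agree because ℍ is supported.
module Submission where

open import Defs
open import Level using (0ℓ; suc)
open import Data.Product using (Σ; _,_; proj₁)
open import Function using (_∘_)
open import Relation.Binary.Bundles using (Setoid)
open import Relation.Binary.PropositionalEquality using (refl)
open import Relation.Nullary using (Dec; ¬_)
open import Relation.Nullary.Decidable using (decidable-stable)
import Relation.Binary.Reasoning.Setoid as SetoidReasoning

≐-setoid : Set → Setoid (suc 0ℓ) 0ℓ
≐-setoid X = record
  { Carrier       = Subset X
  ; _≈_           = _≐_
  ; isEquivalence = record
    { refl  = (λ _ a → a) , (λ _ a → a)
    ; sym   = λ (f , g) → g , f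
    ; trans = λ (f , g) (h , k) → (λ x → h x ∘ f x) , (λ x → g x ∘ k x)
    }
  }

module ≐-Reasoning {X : Set} = SetoidReasoning (≐-setoid X)

⋃-singletons : {X : Set} (S : Subset X) → ⋃ {I = Σ X S} (｛_｝ ∘ proj₁) ≐ S
⋃-singletons S = (λ { _ ((_ , s) , refl) → s }) , (λ x s → (x , s) , refl)

⋂-allBut-∁ : ((P : Set) → Dec P) →
             {X : Set} (D : Subset X) → ⋂ {I = Σ X (∁ D)} (allBut ∘ proj₁) ≐ D
⋂-allBut-∁ lem D =
    (λ x avoids → decidable-stable (lem (D x)) (λ ¬Dx → avoids (x , ¬Dx) refl))
  , (λ { x Dx (x′ , ¬Dx′) refl → ¬Dx′ Dx })

preimage-atoms-join : {X Y : Set} (f : Subset X → Subset Y) →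
                      Respects≐ f → PreservesJoins f → (S : Subset X) →
                      preimage (λ y x → f ｛ x ｝ y) S ≐ f S
preimage-atoms-join {X} f resp joins S = begin
  preimage (λ y x → f ｛ x ｝ y) S   ≈⟨ reindex ⟩
  ⋃ (f ∘ ｛_｝ ∘ proj₁)             ≈⟨ joins (Σ X S) (｛_｝ ∘ proj₁) ⟨
  f (⋃ (｛_｝ ∘ proj₁))             ≈⟨ resp _ _ (⋃-singletons S) ⟩
  f S                               ∎
  where
    open ≐-Reasoning
    reindex : preimage (λ y x → f ｛ x ｝ y) S ≐ ⋃ (f ∘ ｛_｝ ∘ proj₁)
    reindex = (λ { _ (x , fy , s) → (x , s) , fy })
            , (λ { _ ((x , s) , fy) → x , fy , s })

∁-preimage-coatoms-meet : ((P : Set) → Dec P) →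
                          {X Y : Set} (f : Subset X → Subset Y) →
                          Respects≐ f → PreservesMeets f → (D : Subset X) →
                          ∁ (preimage (λ y x → ¬ f (allBut x) y) (∁ D)) ≐ f D
∁-preimage-coatoms-meet lem {X} f resp meets D = begin
  ∁ (preimage (λ y x → ¬ f (allBut x) y) (∁ D))   ≈⟨ reindex ⟩
  ⋂ (f ∘ allBut ∘ proj₁)                          ≈⟨ meets (Σ X (∁ D)) (allBut ∘ proj₁) ⟨
  f (⋂ (allBut ∘ proj₁))                          ≈⟨ resp _ _ (⋂-allBut-∁ lem D) ⟩
  f D                                             ∎
  where
    open ≐-Reasoning
    reindex : ∁ (preimage (λ y x → ¬ f (allBut x) y) (∁ D)) ≐ ⋂ (f ∘ allBut ∘ proj₁)
    reindex = (λ y none (x , ¬Dx) →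
                 decidable-stable (lem (f (allBut x) y)) (λ ¬fy → none (x , ¬fy , ¬Dx)))
            , (λ { y all (x , ¬fy , ¬Dx) → ¬fy (all (x , ¬Dx)) })

mainTheorem4 : ((P : Set) → Dec P) →
    {X Y : Set} (x₀ : X) (y₀ : Y) (H : PerfectHMA X Y) →
    SupportedHMA H → SupportedFrame ((H ₊) x₀ y₀)
mainTheorem4 lem x₀ y₀ H supported D = begin
  preimage Rν (∁ (preimage R∋ (∁ D)))               ≈⟨ preimage-atoms-join diaν diaν-resp diaν-joins _ ⟩
  diaν (∁ (preimage R∋ (∁ D)))                      ≈⟨ diaν-resp _ _ (∁-preimage-coatoms-meet lem box∋ box∋-resp box∋-meets D) ⟩
  diaν (box∋ D)                                     ≈⟨ supported D ⟩
  boxνc (dia∌ D)                                    ≈⟨ boxνc-resp _ _ (preimage-atoms-join dia∌ dia∌-resp dia∌-joins D) ⟨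
  boxνc (preimage R∌ D)                             ≈⟨ ∁-preimage-coatoms-meet lem boxνc boxνc-resp boxνc-meets _ ⟨
  ∁ (preimage Rνc (∁ (preimage R∌ D)))              ∎
  where
    open PerfectHMA H
    open NFrame ((H ₊) x₀ y₀) using (R∋; R∌; Rν; Rνc)
    open ≐-Reasoning
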